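{- Let $n\geq 5$ be an integer. Then for every $j$ with $3<j<n$, $\big|\mathcal{A}^\circ_n(2431; 1324)\big|_2^2\big|_3^j\big| = 0$.
   Context: Let $S_n$ be the symmetric group on $[n]=\{1,\dots,n\}$. A permutation $\pi\in S_n$ has one-line form $\pi_1\pi_2\cdots\pi_n$ with $\pi_i=\pi(i)$. For a word $w=w_1\cdots w_n$ of distinct integers and $\tau=\tau_1\cdots\tau_k\in S_k$, $w$ contains $\tau$ if there are indices $i_1<\cdots<i_k$ with $w_{i_s}>w_{i_t}$ iff $\tau_s>\tau_t$ for all $1\le s<t\le k$; otherwise $w$ avoids $\tau$. A permutation $\pi\in S_n$ is a cyclic permutation if it consists of a single $n$-cycle $\pi=(c_1,\dots,c_n)$ (meaning $\pi(c_i)=c_{i+1}$ for $i<n$, $\pi(c_n)=c_1$). Its cycle forms are the words $c_ic_{i+1}\cdots c_nc_1\cdots c_{i-1}$, $1\le i\le n$; the standard cycle form is the one with first entry $1$. $\mathcal{A}^\circ_n(\sigma;\tau)$ is the set of cyclic permutations in $S_n$ whose one-line form avoids $\sigma$ and all of whose cycle forms avoid $\tau$. For $3\le j\le n$, $\mathcal{A}^\circ_n(\sigma;\tau)\big|_2^2\big|_3^j$ is the set of $\pi\in\mathcal{A}^\circ_n(\sigma;\tau)$ whose standard cycle form is $(1,2,c_3,\dots,c_{j-1},3,c_{j+1},\dots,c_n)$, i.e. has $2$ in position $2$ and $3$ in position $j$. -}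

module Defs where

open import Data.Nat using (ℕ; zero; suc; _<_; _>_)
open import Data.Fin using (Fin; toℕ)
import Data.Fin as F
open import Data.Fin.Permutation using (Permutation′; _⟨$⟩ʳ_)
open import Data.Product using (Σ; _×_; ∃)
open import Data.Vec using (Vec; lookup; _∷_; [])
open import Relation.Nullary using (¬_)
open import Relation.Binary.PropositionalEquality using (_≡_)

-- A word of length n with entries in ℕ (distinct entries intended).
Word : ℕ → Set
Word n = Fin n → ℕ

Contains : {n k : ℕ} → Word n → Word k → Set
Contains {n} {k} w τ =
  Σ (Fin k → Fin n) λ ι →
    (∀ s t → s F.< t → ι s F.< ι t) ×
    (∀ s t → s F.< t →
      (w (ι s) > w (ι t) → τ s > τ t) × (τ s > τ t → w (ι s) > w (ι t)))

Avoids : {n k : ℕ} → Word n → Word k → Set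
Avoids w τ = ¬ Contains w τ

pat : {k : ℕ} → Vec ℕ k → Word k
pat v i = lookup v i

p2431 : Word 4
p2431 = pat (2 ∷ 4 ∷ 3 ∷ 1 ∷ [])

p1324 : Word 4
p1324 = pat (1 ∷ 3 ∷ 2 ∷ 4 ∷ [])

iter : {n : ℕ} → Permutation′ n → ℕ → Fin n → Fin n
iter π zero    x = x
iter π (suc k) x = π ⟨$⟩ʳ (iter π k x)

-- one-line form π₁π₂⋯πₙ (values shifted to 0-based; order is unchanged)
oneLine : {n : ℕ} → Permutation′ n → Word n
oneLine π i = toℕ (π ⟨$⟩ʳ i)

-- π is a single n-cycle: every element lies in the orbit of every other
IsCyclic : {n : ℕ} → Permutation′ n → Set
IsCyclic {n} π = ∀ x y → ∃ λ k → iter π k x ≡ y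

-- the cycle form starting at x: x, π(x), π²(x), …, π^{n-1}(x)
-- (for cyclic π, these over all x are exactly the n cycle forms)
cycleForm : {n : ℕ} → Permutation′ n → Fin n → Word n
cycleForm π x t = toℕ (iter π (toℕ t) x)

InA : {n k l : ℕ} → Word k → Word l → Permutation′ n → Set
InA σ τ π = IsCyclic π × Avoids (oneLine π) σ × (∀ x → Avoids (cycleForm π x) τ)

-- standard cycle form (1,2,c₃,…,c_{j-1},3,…): with 0-based values, the cycle
-- starting at element 0 has value 1 at (1-based) position 2 and value 2 at
-- (1-based) position j, i.e. π(0)=1 and π^{j-1}(0)=2.
Restr : {n : ℕ} → ℕ → Permutation′ n → Set
Restr {n} j π = ∀ (z : Fin n) → toℕ z ≡ 0 →
  (toℕ (iter π 1 z) ≡ 1) × (toℕ (iter π (j Data.Nat.∸ 1) z) ≡ 2)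

-- Write the standard cycle form as 0, 1, a, …, 2, b, …, p (0-based values), with 2 at position i ≥ 3
-- and b right after it. Cyclicity makes the orbit entries distinct, so a, b and p = π⁻¹(0) all
-- exceed 2. If a < b, then 1 a 2 b is a 1324 in the cycle form; if b < a, then the one-line
-- values π(0) π(1) π(2) π(p) = 1 a b 0 form a 2431, because 0 < 1 < 2 < p as positions.
module Submission where

open import Defs
open import Data.Nat using (ℕ; zero; suc; _+_; _*_; _∸_; _≤_; _<_; _>_; s≤s; z≤n; NonZero)
open import Data.Nat.Properties
  using (<-asym; <-irrefl; <-trans; <-cmp; ≤-<-trans; m+[n∸m]≡n; m∸n≤m; m<n⇒0<n∸m; <⇒≤; n<1+n)
open import Data.Nat.DivMod using (_%_; _/_; m≡m%n+[m/n]*n; m%n<n)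
open import Data.Fin using (Fin; toℕ; fromℕ<) renaming (zero to 0F; suc to sucF)
import Data.Fin as F
open import Data.Fin.Properties using (toℕ-injective; toℕ-fromℕ<; pigeonhole)
open import Data.Fin.Permutation using (Permutation′; _⟨$⟩ʳ_; _⟨$⟩ˡ_; inverseʳ)
open import Data.Product using (_×_; _,_; proj₁; proj₂)
open import Data.Vec using (_∷_; []; lookup)
open import Function.Bundles using (Injection)
open import Function.Properties.Inverse using (↔⇒↣)
open import Data.Sum using (_⊎_; inj₁; inj₂)
open import Data.Empty using (⊥; ⊥-elim)
open import Function using (_∘_)
open import Relation.Binary using (tri<; tri≈; tri>)
open import Relation.Binary.PropositionalEquality

module _ {n : ℕ} (π : Permutation′ n) where

  iter-+ : ∀ m k x → iter π (m + k) x ≡ iter π m (iter π k x)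
  iter-+ zero    k x = refl
  iter-+ (suc m) k x = cong (π ⟨$⟩ʳ_) (iter-+ m k x)

  iter-injective : ∀ k {x y} → iter π k x ≡ iter π k y → x ≡ y
  iter-injective zero    eq = eq
  iter-injective (suc k) eq = iter-injective k (Injection.injective (↔⇒↣ π) eq)

  iter-*-fixed : ∀ {d x} → iter π d x ≡ x → ∀ q → iter π (q * d) x ≡ x
  iter-*-fixed         fixed zero    = refl
  iter-*-fixed {d} {x} fixed (suc q) = begin
    iter π (d + q * d) x          ≡⟨ iter-+ d (q * d) x ⟩
    iter π d (iter π (q * d) x)   ≡⟨ cong (iter π d) (iter-*-fixed fixed q) ⟩
    iter π d x                    ≡⟨ fixed ⟩
    x                             ∎
    where open ≡-Reasoning

  iter-%-fixed : ∀ {d x} .{{_ : NonZero d}} → iter π d x ≡ x → ∀ k → iter π k x ≡ iter π (k % d) x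
  iter-%-fixed {d} {x} fixed k = begin
    iter π k x                                   ≡⟨ cong (λ m → iter π m x) (m≡m%n+[m/n]*n k d) ⟩
    iter π (k % d + (k / d) * d) x               ≡⟨ iter-+ (k % d) ((k / d) * d) x ⟩
    iter π (k % d) (iter π ((k / d) * d) x)      ≡⟨ cong (iter π (k % d)) (iter-*-fixed fixed (k / d)) ⟩
    iter π (k % d) x                             ∎
    where open ≡-Reasoning

  -- Under a period d, the step count from x to y can be reduced mod d, giving an injection Fin n → Fin d.
  module _ (cyclic : IsCyclic π) {d x} .{{_ : NonZero d}} (fixed : iter π d x ≡ x) where

    steps-mod : Fin n → Fin d
    steps-mod y = fromℕ< (m%n<n (proj₁ (cyclic x y)) d)

    iter-steps-mod : ∀ y → iter π (toℕ (steps-mod y)) x ≡ y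
    iter-steps-mod y = begin
      iter π (toℕ (steps-mod y)) x   ≡⟨ cong (λ m → iter π m x) (toℕ-fromℕ< (m%n<n k d)) ⟩
      iter π (k % d) x               ≡⟨ iter-%-fixed fixed k ⟨
      iter π k x                     ≡⟨ proj₂ (cyclic x y) ⟩
      y                              ∎
      where
      open ≡-Reasoning
      k = proj₁ (cyclic x y)

    steps-mod-injective : ∀ {y y′} → steps-mod y ≡ steps-mod y′ → y ≡ y′
    steps-mod-injective {y} {y′} eq = begin
      y                                 ≡⟨ iter-steps-mod y ⟨
      iter π (toℕ (steps-mod y)) x      ≡⟨ cong (λ r → iter π (toℕ r) x) eq ⟩
      iter π (toℕ (steps-mod y′)) x     ≡⟨ iter-steps-mod y′ ⟩
      y′                                ∎
      where open ≡-Reasoning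

  cyclic⇒aperiodic : IsCyclic π → ∀ {d x} → 0 < d → d < n → iter π d x ≢ x
  cyclic⇒aperiodic cyclic {suc _} _ d<n fixed
    with y , y′ , y<y′ , same ← pigeonhole d<n (steps-mod cyclic fixed)
    = <-irrefl (cong toℕ (steps-mod-injective cyclic fixed same)) y<y′

  cyclic⇒iter-distinct : IsCyclic π → ∀ {k k′} x → k < k′ → k′ < n → iter π k x ≢ iter π k′ x
  cyclic⇒iter-distinct cyclic {k} {k′} x k<k′ k′<n eq =
    cyclic⇒aperiodic cyclic (m<n⇒0<n∸m k<k′) (≤-<-trans (m∸n≤m k′ k) k′<n) (sym (iter-injective k (begin
      iter π k x                     ≡⟨ eq ⟩
      iter π k′ x                    ≡⟨ cong (λ m → iter π m x) (m+[n∸m]≡n (<⇒≤ k<k′)) ⟨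
      iter π (k + (k′ ∸ k)) x        ≡⟨ iter-+ k (k′ ∸ k) x ⟩
      iter π k (iter π (k′ ∸ k) x)   ∎)))
    where open ≡-Reasoning

  cyclic⇒iter≢preimage : IsCyclic π → ∀ {k} x → suc k < n → iter π k x ≢ π ⟨$⟩ˡ x
  cyclic⇒iter≢preimage cyclic x sk<n eq =
    cyclic⇒aperiodic cyclic (s≤s z≤n) sk<n (trans (cong (π ⟨$⟩ʳ_) eq) (inverseʳ π))

OrderAgrees : ℕ → ℕ → ℕ → ℕ → Set
OrderAgrees x y u v = (x > y → u > v) × (u > v → x > y)

both-< : ∀ {x y u v} → x < y → u < v → OrderAgrees x y u v
both-< x<y u<v = (λ x>y → ⊥-elim (<-asym x<y x>y)) , (λ u>v → ⊥-elim (<-asym u<v u>v))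

both-> : ∀ {x y u v} → x > y → u > v → OrderAgrees x y u v
both-> x>y u>v = (λ _ → u>v) , (λ _ → x>y)

all-pairs₄ : (P : Fin 4 → Fin 4 → Set) →
  P 0F (sucF 0F) → P 0F (sucF (sucF 0F)) → P 0F (sucF (sucF (sucF 0F))) →
  P (sucF 0F) (sucF (sucF 0F)) → P (sucF 0F) (sucF (sucF (sucF 0F))) →
  P (sucF (sucF 0F)) (sucF (sucF (sucF 0F))) →
  ∀ s t → s F.< t → P s t
all-pairs₄ P p01 p02 p03 p12 p13 p23 = λ where
  0F                      (sucF 0F)                      _ → p01
  0F                      (sucF (sucF 0F))               _ → p02
  0F                      (sucF (sucF (sucF 0F)))        _ → p03
  (sucF 0F)               (sucF (sucF 0F))               _ → p12
  (sucF 0F)               (sucF (sucF (sucF 0F)))        _ → p13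
  (sucF (sucF 0F))        (sucF (sucF (sucF 0F)))        _ → p23
  0F                      0F                             ()
  (sucF 0F)               0F                             ()
  (sucF 0F)               (sucF 0F)                      (s≤s ())
  (sucF (sucF 0F))        0F                             ()
  (sucF (sucF 0F))        (sucF 0F)                      (s≤s ())
  (sucF (sucF 0F))        (sucF (sucF 0F))               (s≤s (s≤s ()))
  (sucF (sucF (sucF 0F))) 0F                             ()
  (sucF (sucF (sucF 0F))) (sucF 0F)                      (s≤s ())
  (sucF (sucF (sucF 0F))) (sucF (sucF 0F))               (s≤s (s≤s ()))
  (sucF (sucF (sucF 0F))) (sucF (sucF (sucF 0F)))        (s≤s (s≤s (s≤s ())))

module _ {n : ℕ} (w : Word n) {i₀ i₁ i₂ i₃ : Fin n}
         (i₀<i₁ : i₀ F.< i₁) (i₁<i₂ : i₁ F.< i₂) (i₂<i₃ : i₂ F.< i₃) where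

  private
    ι : Fin 4 → Fin n
    ι = lookup (i₀ ∷ i₁ ∷ i₂ ∷ i₃ ∷ [])

    ι-increasing : ∀ s t → s F.< t → ι s F.< ι t
    ι-increasing = all-pairs₄ (λ s t → ι s F.< ι t)
      i₀<i₁ (<-trans i₀<i₁ i₁<i₂) (<-trans i₀<i₁ (<-trans i₁<i₂ i₂<i₃))
      i₁<i₂ (<-trans i₁<i₂ i₂<i₃) i₂<i₃

    Agrees : Word 4 → Fin 4 → Fin 4 → Set
    Agrees τ s t = OrderAgrees (w (ι s)) (w (ι t)) (τ s) (τ t)

  contains-1324 : w i₀ < w i₂ → w i₂ < w i₁ → w i₁ < w i₃ → Contains w p1324
  contains-1324 w₀<w₂ w₂<w₁ w₁<w₃ = ι , ι-increasing , all-pairs₄ (Agrees p1324)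
    (both-< (<-trans w₀<w₂ w₂<w₁) (s≤s (s≤s z≤n)))
    (both-< w₀<w₂ (s≤s (s≤s z≤n)))
    (both-< (<-trans w₀<w₂ (<-trans w₂<w₁ w₁<w₃)) (s≤s (s≤s z≤n)))
    (both-> w₂<w₁ (s≤s (s≤s (s≤s z≤n))))
    (both-< w₁<w₃ (s≤s (s≤s (s≤s (s≤s z≤n)))))
    (both-< (<-trans w₂<w₁ w₁<w₃) (s≤s (s≤s (s≤s z≤n))))

  contains-2431 : w i₃ < w i₀ → w i₀ < w i₂ → w i₂ < w i₁ → Contains w p2431
  contains-2431 w₃<w₀ w₀<w₂ w₂<w₁ = ι , ι-increasing , all-pairs₄ (Agrees p2431)
    (both-< (<-trans w₀<w₂ w₂<w₁) (s≤s (s≤s (s≤s z≤n))))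
    (both-< w₀<w₂ (s≤s (s≤s (s≤s z≤n))))
    (both-> w₃<w₀ (s≤s (s≤s z≤n)))
    (both-> w₂<w₁ (s≤s (s≤s (s≤s (s≤s z≤n)))))
    (both-> (<-trans w₃<w₀ (<-trans w₀<w₂ w₂<w₁)) (s≤s (s≤s z≤n)))
    (both-> (<-trans w₃<w₀ w₀<w₂) (s≤s (s≤s z≤n)))

n≢0∧n≢1∧n≢2⇒2<n : ∀ n → n ≢ 0 → n ≢ 1 → n ≢ 2 → 2 < n
n≢0∧n≢1∧n≢2⇒2<n 0                   n≢0 _   _   = ⊥-elim (n≢0 refl)
n≢0∧n≢1∧n≢2⇒2<n 1                   _   n≢1 _   = ⊥-elim (n≢1 refl)
n≢0∧n≢1∧n≢2⇒2<n 2                   _   _   n≢2 = ⊥-elim (n≢2 refl)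
n≢0∧n≢1∧n≢2⇒2<n (suc (suc (suc _))) _   _   _   = s≤s (s≤s (s≤s z≤n))

module _ {m : ℕ} (π : Permutation′ (suc m)) (cyclic : IsCyclic π)
         {i : ℕ} (2<i : 2 < i) (1+i<n : suc i < suc m)
         (value-1 : toℕ (iter π 1 0F) ≡ 1) (value-i : toℕ (iter π i 0F) ≡ 2) where

  private
    n = suc m

    orbit : ℕ → Fin n
    orbit k = iter π k 0F

    value : ℕ → ℕ
    value k = toℕ (orbit k)

    i<n : i < n
    i<n = <-trans (n<1+n i) 1+i<n

    2<n : 2 < n
    2<n = <-trans 2<i i<n

    1<n : 1 < n
    1<n = <-trans (n<1+n 1) 2<n

    orbit-distinct : ∀ {k k′} → k < k′ → k′ < n → orbit k′ ≢ orbit k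
    orbit-distinct k<k′ k′<n = cyclic⇒iter-distinct π cyclic 0F k<k′ k′<n ∘ sym

    outside-orbit-0-1-i⇒2< : ∀ z → z ≢ orbit 0 → z ≢ orbit 1 → z ≢ orbit i → 2 < toℕ z
    outside-orbit-0-1-i⇒2< z z≢0 z≢1 z≢2 = n≢0∧n≢1∧n≢2⇒2<n (toℕ z)
      (z≢0 ∘ toℕ-injective)
      (z≢1 ∘ toℕ-injective ∘ (λ e → trans e (sym value-1)))
      (z≢2 ∘ toℕ-injective ∘ (λ e → trans e (sym value-i)))

    a b : ℕ
    a = value 2
    b = value (suc i)

    2<a : 2 < a
    2<a = outside-orbit-0-1-i⇒2< (orbit 2)
      (orbit-distinct (s≤s z≤n) 2<n) (orbit-distinct (n<1+n 1) 2<n) (orbit-distinct 2<i i<n ∘ sym)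

    2<b : 2 < b
    2<b = outside-orbit-0-1-i⇒2< (orbit (suc i))
      (orbit-distinct (s≤s z≤n) 1+i<n) (orbit-distinct (s≤s 0<i) 1+i<n) (orbit-distinct (n<1+n i) 1+i<n)
      where 0<i = <-trans (s≤s z≤n) (<-trans (n<1+n 1) 2<i)

    preimage : Fin n
    preimage = π ⟨$⟩ˡ 0F

    2<preimage : 2 < toℕ preimage
    2<preimage = outside-orbit-0-1-i⇒2< preimage
      (≢-sym (cyclic⇒iter≢preimage π cyclic 0F 1<n))
      (≢-sym (cyclic⇒iter≢preimage π cyclic 0F 2<n))
      (≢-sym (cyclic⇒iter≢preimage π cyclic 0F 1+i<n))

    position : ∀ {k} → k < n → Fin n
    position k<n = fromℕ< k<n

    position-< : ∀ {k k′} (k<n : k < n) (k′<n : k′ < n) → k < k′ → position k<n F.< position k′<n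
    position-< k<n k′<n = subst₂ _<_ (sym (toℕ-fromℕ< k<n)) (sym (toℕ-fromℕ< k′<n))

    cycleForm-< : ∀ {k k′} (k<n : k < n) (k′<n : k′ < n) → value k < value k′ →
                  cycleForm π 0F (position k<n) < cycleForm π 0F (position k′<n)
    cycleForm-< k<n k′<n = subst₂ (λ t t′ → toℕ (orbit t) < toℕ (orbit t′))
      (sym (toℕ-fromℕ< k<n)) (sym (toℕ-fromℕ< k′<n))

  1324-in-cycleForm⊎2431-in-oneLine : Contains (cycleForm π 0F) p1324 ⊎ Contains (oneLine π) p2431
  1324-in-cycleForm⊎2431-in-oneLine with <-cmp a b
  ... | tri≈ _ a≡b _ = ⊥-elim (orbit-distinct (<-trans 2<i (n<1+n i)) 1+i<n (sym (toℕ-injective a≡b)))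
  ... | tri< a<b _ _ = inj₁ (contains-1324 (cycleForm π 0F)
          (position-< 1<n 2<n (n<1+n 1)) (position-< 2<n i<n 2<i) (position-< i<n 1+i<n (n<1+n i))
          (cycleForm-< 1<n i<n (subst₂ _<_ (sym value-1) (sym value-i) (n<1+n 1)))
          (cycleForm-< i<n 2<n (subst (_< a) (sym value-i) 2<a))
          (cycleForm-< 2<n 1+i<n a<b))
  ... | tri> _ _ b<a = inj₂ (contains-2431 (oneLine π) {orbit 0} {orbit 1} {orbit i} {preimage}
          (subst (0 <_) (sym value-1) (s≤s z≤n))
          (subst₂ _<_ (sym value-1) (sym value-i) (n<1+n 1))
          (subst (_< toℕ preimage) (sym value-i) 2<preimage)
          (subst₂ _<_ (sym (cong toℕ (inverseʳ π))) (sym value-1) (s≤s z≤n))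
          (subst (_< b) (sym value-1) (<-trans (n<1+n 1) 2<b))
          b<a)

lemma2p3 : (n : ℕ) → 5 ≤ n → (j : ℕ) → 3 < j → j < n →
    (π : Permutation′ n) → InA p2431 p1324 π × Restr j π → ⊥
lemma2p3 (suc m) _ (suc i) (s≤s 2<i) 1+i<n π ((cyclic , avoids-2431 , avoids-1324) , restricted)
  with 1324-in-cycleForm⊎2431-in-oneLine π cyclic 2<i 1+i<n value-1 value-i
  where
  value-1 = proj₁ (restricted 0F refl)
  value-i = proj₂ (restricted 0F refl)
... | inj₁ contains-1324 = avoids-1324 0F contains-1324
... | inj₂ contains-2431 = avoids-2431 contains-2431
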